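{- Let $n\ge2$ be an integer, and for $1\le i\le n-1$ let $B_i$ be the set of ordered pairs $(\gamma,\delta)$ of $(n+1)$-cycles on $\{0,1,\dots,n\}$ with $\gamma\circ\delta=X_n$ and $\delta$ of the form $(0\;n\;i\;\cdots)$ (i.e. $\delta(0)=n$ and $\delta(n)=i$). Then: (1) for every $1\le i\le n-2$ there is an injection from $B_i$ to $B_{i+1}$; (2) there is an injection from $B_{n-1}$ to $B_1$.
   Context: $X_n$ denotes the cycle $(0\;1\;2\;\cdots\;n)$ on $\{0,\dots,n\}$. Cycle notation $(c_1\cdots c_k)$ sends $c_1\mapsto c_2\mapsto\cdots\mapsto c_k\mapsto c_1$; composition is right-to-left. -}

module Defs where

open import Data.Nat using (ℕ; zero; suc; _≤_; _+_; _∸_)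
open import Data.Fin using (Fin; zero; suc; fromℕ; toℕ; fromℕ<; inject₁)
open import Data.Fin.Permutation using (Permutation′; _⟨$⟩ʳ_)
open import Data.Product using (Σ; ∃; _×_; _,_; proj₁)
open import Relation.Binary.PropositionalEquality using (_≡_)
open import Function using (_∘_)

Perm : ℕ → Set
Perm n = Permutation′ (suc n)

iter : ∀ {A : Set} → (A → A) → ℕ → A → A
iter f zero    x = x
iter f (suc m) x = f (iter f m x)

-- σ is an (n+1)-cycle on {0,…,n}: the orbit of 0 is the whole set
IsFullCycle : ∀ {n} → Perm n → Set
IsFullCycle {n} σ = ∀ (k : Fin (suc n)) → ∃ λ m → iter (σ ⟨$⟩ʳ_) m zero ≡ k

-- X_n = (0 1 2 … n) : k ↦ k+1 for k < n, n ↦ 0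
X : ∀ n → Fin (suc n) → Fin (suc n)
X zero    zero    = zero
X (suc n) zero    = suc zero
X (suc n) (suc k) with X n k
... | zero  = zero
... | suc j = suc (suc j)

-- B_i (i given as a natural number, intended 1 ≤ i ≤ n-1, so i < n+1):
-- pairs (γ,δ) of (n+1)-cycles with γ ∘ δ = X_n, δ(0) = n, δ(n) = i
record B (n i : ℕ) : Set where
  field
    γ δ     : Perm n
    γ-cycle : IsFullCycle γ
    δ-cycle : IsFullCycle δ
    comp    : ∀ k → γ ⟨$⟩ʳ (δ ⟨$⟩ʳ k) ≡ X n k
    δ0      : δ ⟨$⟩ʳ zero ≡ fromℕ n
    δn      : toℕ (δ ⟨$⟩ʳ fromℕ n) ≡ i

_≈B_ : ∀ {n i} → B n i → B n i → Set
_≈B_ {n} x y = (∀ k → B.γ x ⟨$⟩ʳ k ≡ B.γ y ⟨$⟩ʳ k) × (∀ k → B.δ x ⟨$⟩ʳ k ≡ B.δ y ⟨$⟩ʳ k)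

Injection : ℕ → ℕ → ℕ → Set
Injection n i j = Σ (B n i → B n j) λ f → ∀ x y → f x ≈B f y → x ≈B y

-- For n ≥ 3 let ρ = (1 2 ⋯ n−1); it fixes 0 and n, sends i to i+1 for 1 ≤ i ≤ n−2 and n−1 to 1.
-- Then τ = ρ⁻¹XρX⁻¹ is the 3-cycle (n 1 n−1), and (γ, δ) ↦ (ρτγρ⁻¹, ρδρ⁻¹) maps B_i into
-- B_{i+1} (and B_{n−1} into B_1): the product is ρτXρ⁻¹ = X, and ρδρ⁻¹ sends 0 ↦ n ↦ ρ(i).
-- Conjugates of (n+1)-cycles are (n+1)-cycles, and so is τγ, because γ(n) = γ(δ(0)) = 1
-- and composing (n 1 n−1) after a cycle that maps n to 1 merely reorders that cycle.
-- The map is injective since conjugation and composition with τ are.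

module Submission where

open import Defs
open import Data.Nat using (ℕ; zero; suc; _≤_; _<_; _+_; _∸_; _*_; s≤s)
open import Data.Nat.Properties using (+-comm; +-suc; *-suc; m+[n∸m]≡n; n<1+n; <⇒≢; m≤n⇒m≤1+n)
open import Data.Fin using (Fin; zero; suc; toℕ; fromℕ; inject₁; _≟_)
open import Data.Fin.Properties
  using (toℕ-injective; pigeonhole; toℕ-fromℕ; toℕ-inject₁; fromℕ≢inject₁; inject₁-injective)
open import Data.Fin.Permutation
  using (Permutation′; permutation; _⟨$⟩ʳ_; _⟨$⟩ˡ_; inverseˡ; inverseʳ; flip; _∘ₚ_; transpose; _≈_)
open import Data.Product using (∃; _×_; _,_)
open import Data.Sum using (_⊎_; inj₁; inj₂)
open import Function using (_∘_)
import Function.Bundles as Bundles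
open import Function.Definitions using (Injective)
open import Function.Properties.Inverse using (↔⇒↣)
open import Relation.Nullary using (yes; no; contradiction)
open import Relation.Binary.PropositionalEquality
open ≡-Reasoning

module _ {A : Set} (f : A → A) where

  iter-+ : ∀ a b x → iter f (a + b) x ≡ iter f a (iter f b x)
  iter-+ zero    b x = refl
  iter-+ (suc a) b x = cong f (iter-+ a b x)

  iter-periodic : ∀ {P x} → iter f P x ≡ x → ∀ k → iter f (k * P) x ≡ x
  iter-periodic         per zero    = refl
  iter-periodic {P} {x} per (suc k) = begin
    iter f (P + k * P) x        ≡⟨ iter-+ P (k * P) x ⟩
    iter f P (iter f (k * P) x) ≡⟨ cong (iter f P) (iter-periodic per k) ⟩
    iter f P x                  ≡⟨ per ⟩
    x                           ∎

  iter-injective : Injective _≡_ _≡_ f → ∀ m → Injective _≡_ _≡_ (iter f m)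
  iter-injective inj zero    e = e
  iter-injective inj (suc m) e = iter-injective inj m (inj e)

  iter-closed : (P : A → Set) → (∀ {x} → P x → P (f x)) → ∀ {x} → P x → ∀ m → P (iter f m x)
  iter-closed P step px zero    = px
  iter-closed P step px (suc m) = step (iter-closed P step px m)

  Reach : A → A → Set
  Reach x y = ∃ λ m → iter f m x ≡ y

  reach-refl : ∀ {x} → Reach x x
  reach-refl = 0 , refl

  reach-step : ∀ {x y} → Reach x y → Reach x (f y)
  reach-step (m , e) = suc m , cong f e

  reach-trans : ∀ {x y z} → Reach x y → Reach y z → Reach x z
  reach-trans {x} (m , refl) (m′ , refl) = m′ + m , iter-+ m′ m x

  reach-closed : (P : A → Set) → (∀ {x} → P x → P (f x)) → ∀ {x y} → Reach x y → P x → P y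
  reach-closed P step (m , refl) px = iter-closed P step px m

  reach-pred : Injective _≡_ _≡_ f → ∀ {x y z} → x ≢ z → Reach x z → f y ≡ z → Reach x y
  reach-pred inj x≢z (zero  , e) _   = contradiction e x≢z
  reach-pred inj x≢z (suc m , e) fy≡z = m , inj (trans e (sym fy≡z))

  reach-back : ∀ {P x y} → iter f (suc P) x ≡ x → Reach x y → Reach y x
  reach-back {P} {x} per (u , refl) = u * P , (begin
    iter f (u * P) (iter f u x) ≡⟨ sym (iter-+ (u * P) u x) ⟩
    iter f (u * P + u) x        ≡⟨ cong (λ k → iter f k x) (trans (+-comm (u * P) u) (sym (*-suc u P))) ⟩
    iter f (u * suc P) x        ≡⟨ iter-periodic per u ⟩
    x                           ∎)

module _ {A B : Set} {f : A → A} {g : B → B} {h : A → B} (h∘f≗g∘h : ∀ x → h (f x) ≡ g (h x)) where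

  iter-semiconj : ∀ m x → iter g m (h x) ≡ h (iter f m x)
  iter-semiconj zero    x = refl
  iter-semiconj (suc m) x = trans (cong g (iter-semiconj m x)) (sym (h∘f≗g∘h (iter f m x)))

module _ {n : ℕ} {f : Fin n → Fin n} (inj : Injective _≡_ _≡_ f) where

  period : ∀ x → ∃ λ P → iter f (suc P) x ≡ x
  period x with pigeonhole (n<1+n n) (λ (k : Fin (suc n)) → iter f (toℕ k) x)
  ... | i , j , i<j , e = d , iter-injective f inj (toℕ i) (begin
    iter f (toℕ i) (iter f (suc d) x) ≡⟨ sym (iter-+ f (toℕ i) (suc d) x) ⟩
    iter f (toℕ i + suc d) x          ≡⟨ cong (λ k → iter f k x) (trans (+-suc (toℕ i) d) (m+[n∸m]≡n i<j)) ⟩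
    iter f (toℕ j) x                  ≡⟨ sym e ⟩
    iter f (toℕ i) x                  ∎)
    where
    d : ℕ
    d = toℕ j ∸ suc (toℕ i)

  reach-everywhere : ∀ {x} → (∀ y → Reach f x y) → ∀ y z → Reach f y z
  reach-everywhere {x} from-x y z with period x
  ... | P , per = reach-trans f (reach-back f {P} per (from-x y)) (from-x z)

Perm-injective : ∀ {n} (π : Perm n) → Injective _≡_ _≡_ (π ⟨$⟩ʳ_)
Perm-injective π = Bundles.Injection.injective (↔⇒↣ π)

inverse-fixed : ∀ {n} (π : Perm n) {x} → π ⟨$⟩ʳ x ≡ x → π ⟨$⟩ˡ x ≡ x
inverse-fixed π {x} e = trans (cong (π ⟨$⟩ˡ_) (sym e)) (inverseˡ π)

∘ₚ-cancelʳ : ∀ {n} (σ σ′ τ : Perm n) → σ ∘ₚ τ ≈ σ′ ∘ₚ τ → σ ≈ σ′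
∘ₚ-cancelʳ σ σ′ τ e k = Perm-injective τ (e k)

conjugate : ∀ {n} → Perm n → Perm n → Perm n
conjugate ρ σ = flip ρ ∘ₚ σ ∘ₚ ρ

conjugate-cancel : ∀ {n} (ρ σ σ′ : Perm n) → conjugate ρ σ ≈ conjugate ρ σ′ → σ ≈ σ′
conjugate-cancel ρ σ σ′ e k = Perm-injective ρ (begin
  ρ ⟨$⟩ʳ (σ ⟨$⟩ʳ k)                    ≡⟨ cong (λ z → ρ ⟨$⟩ʳ (σ ⟨$⟩ʳ z)) (inverseˡ ρ) ⟨
  conjugate ρ σ ⟨$⟩ʳ (ρ ⟨$⟩ʳ k)         ≡⟨ e (ρ ⟨$⟩ʳ k) ⟩
  conjugate ρ σ′ ⟨$⟩ʳ (ρ ⟨$⟩ʳ k)        ≡⟨ cong (λ z → ρ ⟨$⟩ʳ (σ′ ⟨$⟩ʳ z)) (inverseˡ ρ) ⟩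
  ρ ⟨$⟩ʳ (σ′ ⟨$⟩ʳ k)                    ∎)

conjugate-IsFullCycle : ∀ {n} (ρ σ : Perm n) → ρ ⟨$⟩ʳ zero ≡ zero →
                        IsFullCycle σ → IsFullCycle (conjugate ρ σ)
conjugate-IsFullCycle ρ σ ρ0 σ-cycle k with σ-cycle (ρ ⟨$⟩ˡ k)
... | m , e = m , (begin
  iter (conjugate ρ σ ⟨$⟩ʳ_) m zero          ≡⟨ cong (iter (conjugate ρ σ ⟨$⟩ʳ_) m) ρ0 ⟨
  iter (conjugate ρ σ ⟨$⟩ʳ_) m (ρ ⟨$⟩ʳ zero) ≡⟨ iter-semiconj ρσ≗conj m zero ⟩
  ρ ⟨$⟩ʳ iter (σ ⟨$⟩ʳ_) m zero               ≡⟨ cong (ρ ⟨$⟩ʳ_) e ⟩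
  ρ ⟨$⟩ʳ (ρ ⟨$⟩ˡ k)                          ≡⟨ inverseʳ ρ ⟩
  k                                          ∎)
  where
  ρσ≗conj : ∀ x → ρ ⟨$⟩ʳ (σ ⟨$⟩ʳ x) ≡ conjugate ρ σ ⟨$⟩ʳ (ρ ⟨$⟩ʳ x)
  ρσ≗conj x = cong (λ z → ρ ⟨$⟩ʳ (σ ⟨$⟩ʳ z)) (sym (inverseˡ ρ))

module _ {n : ℕ} (i j : Fin n) where

  transpose-i : transpose i j ⟨$⟩ʳ i ≡ j
  transpose-i with i ≟ i
  ... | yes _   = refl
  ... | no i≢i = contradiction refl i≢i

  transpose-j : transpose i j ⟨$⟩ʳ j ≡ i
  transpose-j with j ≟ i
  ... | yes j≡i = j≡i
  ... | no _ with j ≟ j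
  ...   | yes _   = refl
  ...   | no j≢j = contradiction refl j≢j

  transpose-fixed : ∀ {k} → k ≢ i → k ≢ j → transpose i j ⟨$⟩ʳ k ≡ k
  transpose-fixed {k} k≢i k≢j with k ≟ i
  ... | yes k≡i = contradiction k≡i k≢i
  ... | no _ with k ≟ j
  ...   | yes k≡j = contradiction k≡j k≢j
  ...   | no _    = refl

cycle₃ : ∀ {n} → Fin n → Fin n → Fin n → Permutation′ n
cycle₃ a b c = transpose a b ∘ₚ transpose a c

module Cycle₃ {n : ℕ} {a b c : Fin n} (a≢b : a ≢ b) (b≢c : b ≢ c) (a≢c : a ≢ c) where

  a↦b : cycle₃ a b c ⟨$⟩ʳ a ≡ b
  a↦b = trans (cong (transpose a c ⟨$⟩ʳ_) (transpose-i a b)) (transpose-fixed a c (a≢b ∘ sym) b≢c)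

  b↦c : cycle₃ a b c ⟨$⟩ʳ b ≡ c
  b↦c = trans (cong (transpose a c ⟨$⟩ʳ_) (transpose-j a b)) (transpose-i a c)

  c↦a : cycle₃ a b c ⟨$⟩ʳ c ≡ a
  c↦a = trans (cong (transpose a c ⟨$⟩ʳ_) (transpose-fixed a b (a≢c ∘ sym) (b≢c ∘ sym))) (transpose-j a c)

  fixed : ∀ {x} → x ≢ a → x ≢ b → x ≢ c → cycle₃ a b c ⟨$⟩ʳ x ≡ x
  fixed x≢a x≢b x≢c =
    trans (cong (transpose a c ⟨$⟩ʳ_) (transpose-fixed a b x≢a x≢b)) (transpose-fixed a c x≢a x≢c)

-- Along γ = (a b ⋯ c ⋯), the product cycle₃ a b c after γ runs b ⋯ a c ⋯ b.
∘ₚ-cycle₃-IsFullCycle : ∀ {n} {a b c : Fin (suc n)} (γ : Perm n) → IsFullCycle γ →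
                        a ≢ b → b ≢ c → a ≢ c → γ ⟨$⟩ʳ a ≡ b → IsFullCycle (γ ∘ₚ cycle₃ a b c)
∘ₚ-cycle₃-IsFullCycle {n} {a} {b} {c} γ γ-cycle a≢b b≢c a≢c γa≡b =
  reach-everywhere (Perm-injective μ) reachable-from-b zero
  where
  open Cycle₃ a≢b b≢c a≢c
  μ : Perm n
  μ = γ ∘ₚ cycle₃ a b c

  Reachμ : Fin (suc n) → Fin (suc n) → Set
  Reachμ = Reach (μ ⟨$⟩ʳ_)

  μa≡c : μ ⟨$⟩ʳ a ≡ c
  μa≡c = trans (cong (cycle₃ a b c ⟨$⟩ʳ_) γa≡b) b↦c

  -- Adding a makes S closed under γ before we know that b reaches a.
  S : Fin (suc n) → Set
  S x = Reachμ b x ⊎ x ≡ a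

  enter : ∀ {x y} → Reachμ b x → γ ⟨$⟩ʳ x ≡ y → S y
  enter {y = y} r γx≡y with y ≟ a | y ≟ b | y ≟ c
  ... | yes y≡a | _        | _        = inj₂ y≡a
  ... | no _    | yes refl | _        = inj₁ (reach-refl _)
  ... | no _    | no _     | yes refl =
    inj₁ (subst (Reachμ b) μa≡c (reach-step _ (subst (Reachμ b) μx≡a (reach-step _ r))))
    where
    μx≡a : μ ⟨$⟩ʳ _ ≡ a
    μx≡a = trans (cong (cycle₃ a b c ⟨$⟩ʳ_) γx≡y) c↦a
  ... | no y≢a  | no y≢b   | no y≢c   =
    inj₁ (subst (Reachμ b) (trans (cong (cycle₃ a b c ⟨$⟩ʳ_) γx≡y) (fixed y≢a y≢b y≢c))
                (reach-step _ r))

  S-closed : ∀ {x} → S x → S (γ ⟨$⟩ʳ x)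
  S-closed (inj₁ r)    = enter r refl
  S-closed (inj₂ refl) = inj₁ (subst (Reachμ b) (sym γa≡b) (reach-refl _))

  S-everywhere : ∀ x → S x
  S-everywhere x = reach-closed (γ ⟨$⟩ʳ_) S S-closed
    (reach-everywhere (Perm-injective γ) γ-cycle b x) (inj₁ (reach-refl _))

  reach-c : Reachμ b c
  reach-c with S-everywhere c
  ... | inj₁ r    = r
  ... | inj₂ c≡a = contradiction (sym c≡a) a≢c

  reachable-from-b : ∀ x → Reachμ b x
  reachable-from-b x with S-everywhere x
  ... | inj₁ r    = r
  ... | inj₂ refl = reach-pred _ (Perm-injective μ) b≢c reach-c μa≡c

module Commutation {n : ℕ} (χ : Perm n) {o p q r : Fin (suc n)}
  (χp≡q : χ ⟨$⟩ʳ p ≡ q) (χq≡r : χ ⟨$⟩ʳ q ≡ r) (χr≡o : χ ⟨$⟩ʳ r ≡ o)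
  (o≢p : o ≢ p) (o≢q : o ≢ q) (o≢r : o ≢ r) (p≢q : p ≢ q) (p≢r : p ≢ r) (q≢r : q ≢ r) where

  ≢-image : ∀ {y z w} → y ≢ z → χ ⟨$⟩ʳ z ≡ w → χ ⟨$⟩ʳ y ≢ w
  ≢-image y≢z χz≡w e = y≢z (Perm-injective χ (trans e (sym χz≡w)))

  o′ : Fin (suc n)
  o′ = χ ⟨$⟩ʳ o

  o′≢o : o′ ≢ o
  o′≢o = ≢-image o≢r χr≡o

  o′≢q : o′ ≢ q
  o′≢q = ≢-image o≢p χp≡q

  o′≢r : o′ ≢ r
  o′≢r = ≢-image o≢q χq≡r

  σ τ : Perm n
  σ = cycle₃ o r q
  τ = cycle₃ r o′ q

  module σ = Cycle₃ o≢r (q≢r ∘ sym) o≢q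
  module τ = Cycle₃ (o′≢r ∘ sym) o′≢q (q≢r ∘ sym)

  data Position (y : Fin (suc n)) : Set where
    at-o : y ≡ o → Position y
    at-r : y ≡ r → Position y
    at-q : y ≡ q → Position y
    at-p : y ≡ p → Position y
    elsewhere : y ≢ o → y ≢ r → y ≢ q → y ≢ p → Position y

  position : ∀ y → Position y
  position y with y ≟ o | y ≟ r | y ≟ q | y ≟ p
  ... | yes e | _     | _     | _     = at-o e
  ... | no _  | yes e | _     | _     = at-r e
  ... | no _  | no _  | yes e | _     = at-q e
  ... | no _  | no _  | no _  | yes e = at-p e
  ... | no y≢o | no y≢r | no y≢q | no y≢p = elsewhere y≢o y≢r y≢q y≢p

  cycle₃-commute : ∀ y → σ ⟨$⟩ʳ (τ ⟨$⟩ʳ (χ ⟨$⟩ʳ y)) ≡ χ ⟨$⟩ʳ (σ ⟨$⟩ʳ y)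
  cycle₃-commute y with position y
  ... | at-o refl = begin
    σ ⟨$⟩ʳ (τ ⟨$⟩ʳ o′) ≡⟨ cong (σ ⟨$⟩ʳ_) τ.b↦c ⟩
    σ ⟨$⟩ʳ q           ≡⟨ σ.c↦a ⟩
    o                  ≡⟨ χr≡o ⟨
    χ ⟨$⟩ʳ r           ≡⟨ cong (χ ⟨$⟩ʳ_) σ.a↦b ⟨
    χ ⟨$⟩ʳ (σ ⟨$⟩ʳ o)  ∎
  ... | at-r refl = begin
    σ ⟨$⟩ʳ (τ ⟨$⟩ʳ (χ ⟨$⟩ʳ r)) ≡⟨ cong (λ z → σ ⟨$⟩ʳ (τ ⟨$⟩ʳ z)) χr≡o ⟩
    σ ⟨$⟩ʳ (τ ⟨$⟩ʳ o)          ≡⟨ cong (σ ⟨$⟩ʳ_) (τ.fixed o≢r (o′≢o ∘ sym) o≢q) ⟩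
    σ ⟨$⟩ʳ o                   ≡⟨ σ.a↦b ⟩
    r                          ≡⟨ χq≡r ⟨
    χ ⟨$⟩ʳ q                   ≡⟨ cong (χ ⟨$⟩ʳ_) σ.b↦c ⟨
    χ ⟨$⟩ʳ (σ ⟨$⟩ʳ r)          ∎
  ... | at-q refl = begin
    σ ⟨$⟩ʳ (τ ⟨$⟩ʳ (χ ⟨$⟩ʳ q)) ≡⟨ cong (λ z → σ ⟨$⟩ʳ (τ ⟨$⟩ʳ z)) χq≡r ⟩
    σ ⟨$⟩ʳ (τ ⟨$⟩ʳ r)          ≡⟨ cong (σ ⟨$⟩ʳ_) τ.a↦b ⟩
    σ ⟨$⟩ʳ o′                  ≡⟨ σ.fixed o′≢o o′≢r o′≢q ⟩
    χ ⟨$⟩ʳ o                   ≡⟨ cong (χ ⟨$⟩ʳ_) σ.c↦a ⟨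
    χ ⟨$⟩ʳ (σ ⟨$⟩ʳ q)          ∎
  ... | at-p refl = begin
    σ ⟨$⟩ʳ (τ ⟨$⟩ʳ (χ ⟨$⟩ʳ p)) ≡⟨ cong (λ z → σ ⟨$⟩ʳ (τ ⟨$⟩ʳ z)) χp≡q ⟩
    σ ⟨$⟩ʳ (τ ⟨$⟩ʳ q)          ≡⟨ cong (σ ⟨$⟩ʳ_) τ.c↦a ⟩
    σ ⟨$⟩ʳ r                   ≡⟨ σ.b↦c ⟩
    q                          ≡⟨ χp≡q ⟨
    χ ⟨$⟩ʳ p                   ≡⟨ cong (χ ⟨$⟩ʳ_) (σ.fixed (o≢p ∘ sym) p≢r p≢q) ⟨
    χ ⟨$⟩ʳ (σ ⟨$⟩ʳ p)          ∎
  ... | elsewhere y≢o y≢r y≢q y≢p = begin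
    σ ⟨$⟩ʳ (τ ⟨$⟩ʳ (χ ⟨$⟩ʳ y)) ≡⟨ cong (σ ⟨$⟩ʳ_) (τ.fixed χy≢r (≢-image y≢o refl) χy≢q) ⟩
    σ ⟨$⟩ʳ (χ ⟨$⟩ʳ y)          ≡⟨ σ.fixed (≢-image y≢r χr≡o) χy≢r χy≢q ⟩
    χ ⟨$⟩ʳ y                   ≡⟨ cong (χ ⟨$⟩ʳ_) (σ.fixed y≢o y≢r y≢q) ⟨
    χ ⟨$⟩ʳ (σ ⟨$⟩ʳ y)          ∎
    where
    χy≢r : χ ⟨$⟩ʳ y ≢ r
    χy≢r = ≢-image y≢q χq≡r
    χy≢q : χ ⟨$⟩ʳ y ≢ q
    χy≢q = ≢-image y≢p χp≡q

X-inject₁ : ∀ n (k : Fin n) → X n (inject₁ k) ≡ suc k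
X-inject₁ (suc n) zero    = refl
X-inject₁ (suc n) (suc k) rewrite X-inject₁ n k = refl

X-fromℕ : ∀ n → X n (fromℕ n) ≡ zero
X-fromℕ zero    = refl
X-fromℕ (suc n) rewrite X-fromℕ n = refl

toℕ-X : ∀ n (y : Fin (suc n)) → toℕ y < n → toℕ (X n y) ≡ suc (toℕ y)
toℕ-X (suc n) zero    _        = refl
toℕ-X (suc n) (suc y) (s≤s y<n) with X n y | toℕ-X n y y<n
... | zero  | ()
... | suc _ | e = cong suc e

X⁻¹ : ∀ n → Fin (suc n) → Fin (suc n)
X⁻¹ n zero    = fromℕ n
X⁻¹ n (suc k) = inject₁ k

X-X⁻¹ : ∀ n y → X n (X⁻¹ n y) ≡ y
X-X⁻¹ n zero    = X-fromℕ n
X-X⁻¹ n (suc k) = X-inject₁ n k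

X⁻¹-X : ∀ n y → X⁻¹ n (X n y) ≡ y
X⁻¹-X zero    zero    = refl
X⁻¹-X (suc n) zero    = refl
X⁻¹-X (suc n) (suc y) with X n y | X⁻¹-X n y
... | zero  | e = cong suc e
... | suc _ | e = cong suc e

Xₚ : ∀ n → Perm n
Xₚ n = permutation (X n) (X⁻¹ n) (X-X⁻¹ n) (X⁻¹-X n)

module Transport {n i j : ℕ} (ρ : Perm n) {c : Fin (suc n)}
  (last≢1 : fromℕ n ≢ X n zero) (1≢c : X n zero ≢ c) (last≢c : fromℕ n ≢ c)
  (ρ0 : ρ ⟨$⟩ʳ zero ≡ zero) (ρ-last : ρ ⟨$⟩ʳ fromℕ n ≡ fromℕ n)
  (ρ-commute : ∀ y → ρ ⟨$⟩ʳ (cycle₃ (fromℕ n) (X n zero) c ⟨$⟩ʳ X n y) ≡ X n (ρ ⟨$⟩ʳ y))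
  (ρ-i : ∀ x → toℕ x ≡ i → toℕ (ρ ⟨$⟩ʳ x) ≡ j) where

  τ : Perm n
  τ = cycle₃ (fromℕ n) (X n zero) c

  transport : B n i → B n j
  transport β = record
    { γ       = conjugate ρ (γ ∘ₚ τ)
    ; δ       = conjugate ρ δ
    ; γ-cycle = conjugate-IsFullCycle ρ (γ ∘ₚ τ) ρ0
                  (∘ₚ-cycle₃-IsFullCycle γ γ-cycle last≢1 1≢c last≢c γ-last)
    ; δ-cycle = conjugate-IsFullCycle ρ δ ρ0 δ-cycle
    ; comp    = comp′
    ; δ0      = trans (cong (λ z → ρ ⟨$⟩ʳ (δ ⟨$⟩ʳ z)) (inverse-fixed ρ ρ0))
                      (trans (cong (ρ ⟨$⟩ʳ_) δ0) ρ-last)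
    ; δn      = trans (cong (λ z → toℕ (ρ ⟨$⟩ʳ (δ ⟨$⟩ʳ z))) (inverse-fixed ρ ρ-last)) (ρ-i _ δn)
    }
    where
    open B β
    γ-last : γ ⟨$⟩ʳ fromℕ n ≡ X n zero
    γ-last = trans (cong (γ ⟨$⟩ʳ_) (sym δ0)) (comp zero)

    comp′ : ∀ k → conjugate ρ (γ ∘ₚ τ) ⟨$⟩ʳ (conjugate ρ δ ⟨$⟩ʳ k) ≡ X n k
    comp′ k = begin
      ρ ⟨$⟩ʳ (τ ⟨$⟩ʳ (γ ⟨$⟩ʳ (ρ ⟨$⟩ˡ (ρ ⟨$⟩ʳ (δ ⟨$⟩ʳ (ρ ⟨$⟩ˡ k))))))
        ≡⟨ cong (λ z → ρ ⟨$⟩ʳ (τ ⟨$⟩ʳ (γ ⟨$⟩ʳ z))) (inverseˡ ρ) ⟩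
      ρ ⟨$⟩ʳ (τ ⟨$⟩ʳ (γ ⟨$⟩ʳ (δ ⟨$⟩ʳ (ρ ⟨$⟩ˡ k))))
        ≡⟨ cong (λ z → ρ ⟨$⟩ʳ (τ ⟨$⟩ʳ z)) (comp (ρ ⟨$⟩ˡ k)) ⟩
      ρ ⟨$⟩ʳ (τ ⟨$⟩ʳ X n (ρ ⟨$⟩ˡ k))
        ≡⟨ ρ-commute (ρ ⟨$⟩ˡ k) ⟩
      X n (ρ ⟨$⟩ʳ (ρ ⟨$⟩ˡ k))
        ≡⟨ cong (X n) (inverseʳ ρ) ⟩
      X n k
        ∎

  transport-injective : ∀ x y → transport x ≈B transport y → x ≈B y
  transport-injective x y (γ≈ , δ≈) =
    ∘ₚ-cancelʳ (B.γ x) (B.γ y) τ (conjugate-cancel ρ (B.γ x ∘ₚ τ) (B.γ y ∘ₚ τ) γ≈) ,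
    conjugate-cancel ρ (B.δ x) (B.δ y) δ≈

  injection : Injection n i j
  injection = transport , transport-injective

module Rotation (m : ℕ) where

  n : ℕ
  n = suc (suc (suc m))

  p q : Fin (suc n)
  p = inject₁ (inject₁ (fromℕ (suc m)))
  q = inject₁ (fromℕ (suc (suc m)))

  toℕ-q : toℕ q ≡ suc (suc m)
  toℕ-q = trans (toℕ-inject₁ _) (toℕ-fromℕ _)

  p≢q : p ≢ q
  p≢q e = fromℕ≢inject₁ (sym (inject₁-injective e))

  open Commutation (Xₚ n) {zero} {p} {q} {fromℕ n} (X-inject₁ _ _) (X-inject₁ _ _) (X-fromℕ n)
    (λ ()) (λ ()) (λ ()) p≢q (fromℕ≢inject₁ ∘ sym) (fromℕ≢inject₁ ∘ sym)

  -- the cycle (1 2 ⋯ n−1), which is X ∘ (0 n n−1)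
  ρ : Perm n
  ρ = σ ∘ₚ Xₚ n

  module ρ-transport {i j : ℕ} = Transport {n} {i} {j} ρ (o′≢r ∘ sym) o′≢q fromℕ≢inject₁
    (trans (cong (X n) σ.a↦b) (X-fromℕ n)) (trans (cong (X n) σ.b↦c) (X-inject₁ _ _))
    (λ y → cong (X n) (cycle₃-commute y))

  shift : ∀ i → 1 ≤ i → i ≤ n ∸ 2 → Injection n i (i + 1)
  shift i 1≤i i≤n-2 = ρ-transport.injection ρ-shift
    where
    ρ-shift : ∀ x → toℕ x ≡ i → toℕ (ρ ⟨$⟩ʳ x) ≡ i + 1
    ρ-shift x refl = begin
      toℕ (X n (σ ⟨$⟩ʳ x)) ≡⟨ cong (toℕ ∘ X n) (σ.fixed x≢0 x≢n x≢q) ⟩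
      toℕ (X n x)          ≡⟨ toℕ-X n x (s≤s (m≤n⇒m≤1+n i≤n-2)) ⟩
      suc (toℕ x)          ≡⟨ +-comm 1 (toℕ x) ⟩
      toℕ x + 1            ∎
      where
      x≢0 : x ≢ zero
      x≢0 refl = contradiction 1≤i λ ()
      x≢n : x ≢ fromℕ n
      x≢n e = <⇒≢ (s≤s (m≤n⇒m≤1+n i≤n-2)) (trans (cong toℕ e) (toℕ-fromℕ n))
      x≢q : x ≢ q
      x≢q e = <⇒≢ (s≤s i≤n-2) (trans (cong toℕ e) toℕ-q)

  wrap : Injection n (n ∸ 1) 1
  wrap = ρ-transport.injection ρ-wrap
    where
    ρ-wrap : ∀ x → toℕ x ≡ n ∸ 1 → toℕ (ρ ⟨$⟩ʳ x) ≡ 1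
    ρ-wrap x e rewrite toℕ-injective (trans e (sym toℕ-q)) = cong (toℕ ∘ X n) σ.c↦a

lemma3p9 : ∀ (n : ℕ) → 2 ≤ n →
    ((i : ℕ) → 1 ≤ i → i ≤ n ∸ 2 → Injection n i (i + 1)) × Injection n (n ∸ 1) 1
lemma3p9 (suc zero)          (s≤s ())
lemma3p9 (suc (suc zero))    _ = (λ { _ (s≤s _) () }) , (λ β → β) , (λ _ _ e → e)
lemma3p9 (suc (suc (suc m))) _ = Rotation.shift m , Rotation.wrap m
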